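{- Let $p$ be an odd prime. Then $g(\frac{p-1}{4},p)\ge\frac12\sqrt{2p}-\frac32$ if $p\equiv1\pmod4$; $g(\frac{p-1}{6},p)\ge\frac12\sqrt[3]{6p}-2$ if $p\equiv1\pmod6$; $g(\frac{p-1}{8},p)\ge\frac12\sqrt[4]{24p}-\frac52$ if $p\equiv1\pmod8$; $g(\frac{p-1}{10},p)\ge\frac12\sqrt[5]{120p}-3$ if $p\equiv1\pmod{10}$.
   Context: For a prime $p$ and a positive integer $k\mid p-1$, the Waring number $g(k,p)$ is the least positive integer $s$ such that every element of $\mathbb{F}_p$ can be written as $x_1^k+\cdots+x_s^k$ with $x_i\in\mathbb{F}_p$. -}

module Defs where

open import Data.Nat using (ℕ; _+_; _*_; _^_; _≤_)
open import Data.Fin using (Fin; toℕ)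
open import Data.Vec using (Vec; sum; map)
open import Data.Product using (Σ; ∃; _×_)
open import Relation.Binary.PropositionalEquality using (_≡_)

-- Residues mod p are represented by naturals; elements of 𝔽_p by Fin p.
-- a ∈ 𝔽_p is a sum of s k-th powers: there are x₁,…,xₛ with
-- x₁^k + ⋯ + xₛ^k ≡ a (mod p), i.e. the sum equals toℕ a + q * p for some q
-- (toℕ a < p, so this is exactly congruence mod p).
IsSumOfPowers : (k p s : ℕ) → Fin p → Set
IsSumOfPowers k p s a =
  Σ (Vec ℕ s) λ xs → ∃ λ q → sum (map (λ x → x ^ k) xs) ≡ toℕ a + q * p

AllSumsOfPowers : (k p s : ℕ) → Set
AllSumsOfPowers k p s = (a : Fin p) → IsSumOfPowers k p s a

IsWaringNumber : (k p g : ℕ) → Set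
IsWaringNumber k p g =
  (1 ≤ g) × AllSumsOfPowers k p g × (∀ s → 1 ≤ s → AllSumsOfPowers k p s → g ≤ s)

module Submission where

-- Write p − 1 = 2mk.  By Fermat every k-th power of a unit is a root of y^(2m) − 1.  These roots
-- come in pairs ±r, so by Lagrange's theorem at most m of them, u₁, …, u_m, lie in [1, (p − 1)/2],
-- and every k-th power is 0 or ±u_j modulo p.  A sum of g k-th powers is therefore congruent to
-- e · u for an integer vector e with ‖e‖₁ ≤ g.  Listing these vectors with the sign of zero
-- coordinates doubled gives 2^m·C(g + m, m) of them, so if every residue is such a sum then
-- m!·p ≤ (2g + 2)(2g + 4)⋯(2g + 2m), and pairing factors around 2g + m + 1 bounds the product.

open import Defs
open import Data.Nat.Base as ℕ using (ℕ; zero; suc)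
open import Relation.Binary.PropositionalEquality

module _ where
  open import Data.Nat.Base
  open import Data.Nat.Properties
  open import Data.Nat.Divisibility
  open import Data.Nat.DivMod using (_/_; _%_; m/n*n≡m; m*n/n≡m; m≡m%n+[m/n]*n)
  open import Data.Nat.Primality using (Prime; euclidsLemma; ¬prime[1])
  open import Data.Nat.Combinatorics using (_C_; nCk≡n!/k![n-k]!; k![n∸k]!∣n!)
  open import Data.Sum using (inj₁; inj₂)
  open import Relation.Nullary using (¬_; contradiction)

  ∣∧<⇒≡0 : ∀ {n x} → n ∣ x → x < n → x ≡ 0
  ∣∧<⇒≡0 {x = zero}  _   _   = refl
  ∣∧<⇒≡0 {x = suc x} n∣x x<n = contradiction n∣x (>⇒∤ x<n)

  m%n≡1⇒m∸1≡[m∸1]/n*n : ∀ m n .{{_ : NonZero n}} → m % n ≡ 1 → m ∸ 1 ≡ (m ∸ 1) / n * n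
  m%n≡1⇒m∸1≡[m∸1]/n*n m n m%n≡1 = trans m∸1≡m/n*n (sym (begin
    (m ∸ 1) / n * n     ≡⟨ cong (λ x → x / n * n) m∸1≡m/n*n ⟩
    m / n * n / n * n   ≡⟨ cong (_* n) (m*n/n≡m (m / n) n) ⟩
    m / n * n           ∎))
    where
    open ≡-Reasoning
    m∸1≡m/n*n : m ∸ 1 ≡ m / n * n
    m∸1≡m/n*n = cong (_∸ 1) (trans (m≡m%n+[m/n]*n m n) (cong (_+ m / n * n) m%n≡1))

  nCk*k![n∸k]!≡n! : ∀ {n k} → k ≤ n → (n C k) * (k ! * (n ∸ k) !) ≡ n !
  nCk*k![n∸k]!≡n! {n} {k} k≤n = begin
    (n C k) * (k ! * (n ∸ k) !)                 ≡⟨ cong (_* (k ! * (n ∸ k) !)) (nCk≡n!/k![n-k]! k≤n) ⟩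
    n ! / (k ! * (n ∸ k) !) * (k ! * (n ∸ k) !) ≡⟨ m/n*n≡m (k![n∸k]!∣n! k≤n) ⟩
    n !                                         ∎
    where
    open ≡-Reasoning
    instance _ = k !* (n ∸ k) !≢0

  prime∤! : ∀ {p n} → Prime p → n < p → ¬ p ∣ n !
  prime∤! {n = zero}  p-prime _   p∣1  = ¬prime[1] (subst Prime (∣1⇒≡1 p∣1) p-prime)
  prime∤! {n = suc n} p-prime n<p p∣n! with euclidsLemma (suc n) (n !) p-prime p∣n!
  ... | inj₁ p∣1+n  = <⇒≱ n<p (∣⇒≤ p∣1+n)
  ... | inj₂ p∣n!′ = prime∤! p-prime (<-trans (n<1+n n) n<p) p∣n!′

  prime∣C : ∀ {p k} → Prime p → 0 < k → k < p → p ∣ p C k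
  prime∣C {p@(suc q)} {k} p-prime 0<k k<p
    with euclidsLemma (p C k) (k ! * (p ∸ k) !) p-prime
           (subst (p ∣_) (sym (nCk*k![n∸k]!≡n! (<⇒≤ k<p))) (m∣m*n (q !)))
  ... | inj₁ p∣C = p∣C
  ... | inj₂ p∣k![p∸k]! with euclidsLemma (k !) ((p ∸ k) !) p-prime p∣k![p∸k]!
  ...   | inj₁ p∣k!     = contradiction p∣k! (prime∤! p-prime k<p)
  ...   | inj₂ p∣[p∸k]! = contradiction p∣[p∸k]! (prime∤! p-prime (∸-monoʳ-< 0<k (<⇒≤ k<p)))

-- Counting the ℓ¹-ball

module _ where
  open import Data.Nat.Base
  open import Data.Nat.Properties
  open import Data.Nat.Tactic.RingSolver using (solve-∀)

  mutual
    ballSize : ℕ → ℕ → ℕ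
    ballSize zero    g = 1
    ballSize (suc m) g = coneSize m g + coneSize m g

    coneSize : ℕ → ℕ → ℕ
    coneSize m zero    = ballSize m zero
    coneSize m (suc g) = ballSize m (suc g) + coneSize m g

  risingEvens : ℕ → ℕ → ℕ
  risingEvens zero    g = 1
  risingEvens (suc m) g = risingEvens m g * (2 * g + 2 * suc m)

  risingEvens-suc : ∀ m g → risingEvens (suc m) g ≡ (2 * g + 2) * risingEvens m (suc g)
  risingEvens-suc zero    g = base g
    where base : ∀ g → 1 * (2 * g + 2 * 1) ≡ (2 * g + 2) * 1
          base = solve-∀
  risingEvens-suc (suc m) g = begin
    risingEvens (suc m) g * (2 * g + 2 * suc (suc m))
      ≡⟨ cong (_* (2 * g + 2 * suc (suc m))) (risingEvens-suc m g) ⟩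
    (2 * g + 2) * risingEvens m (suc g) * (2 * g + 2 * suc (suc m))
      ≡⟨ reassociate (2 * g + 2) (risingEvens m (suc g)) g m ⟩
    (2 * g + 2) * (risingEvens m (suc g) * (2 * suc g + 2 * suc m))
      ∎
    where
    open ≡-Reasoning
    reassociate : ∀ a r g m → a * r * (2 * g + 2 * suc (suc m)) ≡ a * (r * (2 * suc g + 2 * suc m))
    reassociate = solve-∀

  mutual
    ballSize-closed-form : ∀ m g → m ! * ballSize m g ≡ risingEvens m g
    ballSize-closed-form zero    g = refl
    ballSize-closed-form (suc m) g = begin
      suc m ! * (coneSize m g + coneSize m g) ≡⟨ regroup m (m !) (coneSize m g) ⟩
      2 * suc m * (m ! * coneSize m g)      ≡⟨ coneSize-closed-form m g ⟩
      risingEvens (suc m) g                 ∎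
      where
      open ≡-Reasoning
      regroup : ∀ m f c → suc m * f * (c + c) ≡ 2 * suc m * (f * c)
      regroup = solve-∀

    coneSize-closed-form : ∀ m g → 2 * suc m * (m ! * coneSize m g) ≡ risingEvens (suc m) g
    coneSize-closed-form m zero = begin
      2 * suc m * (m ! * ballSize m 0) ≡⟨ cong (2 * suc m *_) (ballSize-closed-form m 0) ⟩
      2 * suc m * risingEvens m 0      ≡⟨ *-comm (2 * suc m) (risingEvens m 0) ⟩
      risingEvens m 0 * (2 * suc m)    ∎
      where open ≡-Reasoning
    coneSize-closed-form m (suc g) = begin
      2 * suc m * (m ! * (ballSize m (suc g) + coneSize m g))
        ≡⟨ distribute (2 * suc m) (m !) (ballSize m (suc g)) (coneSize m g) ⟩
      2 * suc m * (m ! * ballSize m (suc g)) + 2 * suc m * (m ! * coneSize m g)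
        ≡⟨ cong₂ (λ b c → 2 * suc m * b + c) (ballSize-closed-form m (suc g)) (coneSize-closed-form m g) ⟩
      2 * suc m * risingEvens m (suc g) + risingEvens (suc m) g
        ≡⟨ cong (2 * suc m * risingEvens m (suc g) +_) (risingEvens-suc m g) ⟩
      2 * suc m * risingEvens m (suc g) + (2 * g + 2) * risingEvens m (suc g)
        ≡⟨ collect m g (risingEvens m (suc g)) ⟩
      risingEvens m (suc g) * (2 * suc g + 2 * suc m)
        ∎
      where
      open ≡-Reasoning
      distribute : ∀ a f b c → a * (f * (b + c)) ≡ a * (f * b) + a * (f * c)
      distribute = solve-∀
      collect : ∀ m g r → 2 * suc m * r + (2 * g + 2) * r ≡ r * (2 * suc g + 2 * suc m)
      collect = solve-∀

  ballSize≤coneSize : ∀ m g → ballSize m g ≤ coneSize m g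
  ballSize≤coneSize m zero    = ≤-refl
  ballSize≤coneSize m (suc g) = m≤m+n _ _

  ballSize-monoˡ : ∀ {m m′} g → m ≤ m′ → ballSize m g ≤ ballSize m′ g
  ballSize-monoˡ {m} g m≤m′ = go (≤⇒≤′ m≤m′)
    where
    go : ∀ {m′} → m ≤′ m′ → ballSize m g ≤ ballSize m′ g
    go (≤′-reflexive refl) = ≤-refl
    go (≤′-step m≤′m′)     = ≤-trans (go m≤′m′) (≤-trans (ballSize≤coneSize _ g) (m≤m+n _ _))

  -- With x = 2g + m + 1 the m factors are symmetric about x, e.g. (x² − 1)(x² − 9) = x⁴ − 10x² + 9
  -- for m = 4; the slack added below is x^m minus the product.
  risingEvens-2≤ : ∀ g → risingEvens 2 g ≤ (2 * g + 3) ^ 2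
  risingEvens-2≤ g = ≤-trans (m≤m+n _ 1) (≤-reflexive (expand g))
    where expand : ∀ g → 1 * (2 * g + 2 * 1) * (2 * g + 2 * 2) + 1
                         ≡ (2 * g + 3) * ((2 * g + 3) * 1)
          expand = solve-∀

  risingEvens-3≤ : ∀ g → risingEvens 3 g ≤ (2 * g + 4) ^ 3
  risingEvens-3≤ g = ≤-trans (m≤m+n _ (4 * (2 * g + 4))) (≤-reflexive (expand g))
    where expand : ∀ g → 1 * (2 * g + 2 * 1) * (2 * g + 2 * 2) * (2 * g + 2 * 3) + 4 * (2 * g + 4)
                         ≡ (2 * g + 4) * ((2 * g + 4) * ((2 * g + 4) * 1))
          expand = solve-∀

  risingEvens-4≤ : ∀ g → risingEvens 4 g ≤ (2 * g + 5) ^ 4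
  risingEvens-4≤ g = ≤-trans (m≤m+n _ (40 * g * g + 200 * g + 241)) (≤-reflexive (expand g))
    where expand : ∀ g → 1 * (2 * g + 2 * 1) * (2 * g + 2 * 2) * (2 * g + 2 * 3) * (2 * g + 2 * 4)
                         + (40 * g * g + 200 * g + 241)
                         ≡ (2 * g + 5) * ((2 * g + 5) * ((2 * g + 5) * ((2 * g + 5) * 1)))
          expand = solve-∀

  risingEvens-5≤ : ∀ g → risingEvens 5 g ≤ (2 * g + 6) ^ 5
  risingEvens-5≤ g = ≤-trans (m≤m+n _ ((2 * g + 6) * (80 * g * g + 480 * g + 656))) (≤-reflexive (expand g))
    where expand : ∀ g → 1 * (2 * g + 2 * 1) * (2 * g + 2 * 2) * (2 * g + 2 * 3) * (2 * g + 2 * 4) * (2 * g + 2 * 5)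
                         + (2 * g + 6) * (80 * g * g + 480 * g + 656)
                         ≡ (2 * g + 6) * ((2 * g + 6) * ((2 * g + 6) * ((2 * g + 6) * ((2 * g + 6) * 1))))
          expand = solve-∀

module _ where
  open import Data.Integer.Base hiding (suc)
  import Data.Integer.Base as ℤ
  open import Data.Integer.Properties
  open import Data.Integer.Divisibility.Signed
  open import Data.Integer.DivMod using (_%_; _/_; a≡a%n+[a/n]*n; n%d<d)
  open import Data.Integer.Tactic.RingSolver using (solve-∀)
  import Data.Nat.Properties as ℕ
  import Data.Nat.Divisibility as ℕ
  import Data.Nat.Tactic.RingSolver as ℕ-Solver
  open import Algebra.Properties.CommutativeSemigroup ℕ.+-commutativeSemigroup using (interchange)
  open import Data.Nat.Combinatorics using (_C_; nCk+nC[k+1]≡[n+1]C[k+1]; k>n⇒nCk≡0; nCn≡1)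
  open import Data.Nat.Primality using (Prime; euclidsLemma; prime⇒nonZero; prime⇒nonTrivial)
  open import Data.Sign.Base using (Sign)
  open import Data.Fin.Base using (Fin; toℕ)
  open import Data.Fin.Properties using (toℕ-injective; toℕ<n; injective⇒≤)
  open import Data.Product using (∃; _×_; _,_; proj₁; proj₂)
  open import Data.Sum as Sum using (_⊎_; inj₁; inj₂)
  open import Data.List.Base as List using (List; []; _∷_; length; _++_)
  open import Data.List.Properties using (length-++; length-map)
  open import Data.List.Membership.Propositional using (_∈_)
  open import Data.List.Membership.Propositional.Properties
    using (∈-map⁺; ∈-++⁺ˡ; ∈-++⁺ʳ; ∈-filter⁺; ∈-applyUpTo⁺)
  open import Data.List.Relation.Unary.All as All using (All; []; _∷_)
  import Data.List.Relation.Unary.All.Properties as AllP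
  open import Data.List.Relation.Unary.AllPairs as AllPairs using (AllPairs; []; _∷_)
  import Data.List.Relation.Unary.AllPairs.Properties as AllPairsP
  import Data.List.Relation.Unary.Any as Any
  open import Data.List.Relation.Unary.Any using (here)
  open import Data.List.Relation.Unary.Any.Properties using (lookup-index)
  open import Data.Vec.Base as Vec using (Vec; []; _∷_)
  open import Data.Vec.Membership.Propositional renaming (_∈_ to _∈ᵥ_) using ()
  open import Data.Vec.Membership.Propositional.Properties using (∈-fromList⁺)
  import Data.Vec.Relation.Unary.Any as Vecᵃ
  open import Function using (_∘_)
  open import Relation.Binary.Bundles using (Setoid)
  import Relation.Binary.Reasoning.Setoid as SetoidReasoning
  open import Relation.Nullary using (¬_; contradiction; Dec; yes; no)
  import Relation.Nullary.Decidable as Dec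

  -- A record rather than a synonym for + n ∣ a - b, so that a and b can be inferred.
  infix 4 _≡_[mod_]
  record _≡_[mod_] (a b : ℤ) (n : ℕ) : Set where
    constructor congruent
    field divides-difference : + n ∣ a - b

  module _ {n : ℕ} where

    ≡-mod-refl : ∀ {a} → a ≡ a [mod n ]
    ≡-mod-refl {a} = congruent (divides 0ℤ (+-inverseʳ a))

    ≡⇒≡-mod : ∀ {a b} → a ≡ b → a ≡ b [mod n ]
    ≡⇒≡-mod refl = ≡-mod-refl

    ≡-mod-sym : ∀ {a b} → a ≡ b [mod n ] → b ≡ a [mod n ]
    ≡-mod-sym {a} {b} (congruent n∣a-b) = congruent (subst (+ n ∣_) (flip a b) (∣m⇒∣-m n∣a-b))
      where flip : ∀ a b → - (a - b) ≡ b - a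
            flip = solve-∀

    ≡-mod-trans : ∀ {a b c} → a ≡ b [mod n ] → b ≡ c [mod n ] → a ≡ c [mod n ]
    ≡-mod-trans {a} {b} {c} (congruent n∣a-b) (congruent n∣b-c) =
      congruent (subst (+ n ∣_) (telescope a b c) (∣m∣n⇒∣m+n n∣a-b n∣b-c))
      where telescope : ∀ a b c → (a - b) + (b - c) ≡ a - c
            telescope = solve-∀

    ≡-mod-setoid : Setoid _ _
    ≡-mod-setoid = record
      { Carrier = ℤ
      ; _≈_ = _≡_[mod n ]
      ; isEquivalence = record { refl = ≡-mod-refl ; sym = ≡-mod-sym ; trans = ≡-mod-trans }
      }

    +-cong-mod : ∀ {a b c d} → a ≡ b [mod n ] → c ≡ d [mod n ] → a + c ≡ b + d [mod n ]
    +-cong-mod {a} {b} {c} {d} (congruent n∣a-b) (congruent n∣c-d) =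
      congruent (subst (+ n ∣_) (regroup a b c d) (∣m∣n⇒∣m+n n∣a-b n∣c-d))
      where regroup : ∀ a b c d → (a - b) + (c - d) ≡ (a + c) - (b + d)
            regroup = solve-∀

    *-cong-mod : ∀ {a b c d} → a ≡ b [mod n ] → c ≡ d [mod n ] → a * c ≡ b * d [mod n ]
    *-cong-mod {a} {b} {c} {d} (congruent n∣a-b) (congruent n∣c-d) =
      congruent (subst (+ n ∣_) (regroup a b c d) (∣m∣n⇒∣m+n (∣m⇒∣m*n c n∣a-b) (∣n⇒∣m*n b n∣c-d)))
      where regroup : ∀ a b c d → (a - b) * c + b * (c - d) ≡ a * c - b * d
            regroup = solve-∀

    -‿cong-mod : ∀ {a b} → a ≡ b [mod n ] → - a ≡ - b [mod n ]
    -‿cong-mod {a} {b} (congruent n∣a-b) = congruent (subst (+ n ∣_) (regroup a b) (∣m⇒∣-m n∣a-b))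
      where regroup : ∀ a b → - (a - b) ≡ - a - - b
            regroup = solve-∀

    ^-cong-mod : ∀ {a b} k → a ≡ b [mod n ] → a ^ k ≡ b ^ k [mod n ]
    ^-cong-mod zero    a≡b = ≡-mod-refl
    ^-cong-mod (suc k) a≡b = *-cong-mod a≡b (^-cong-mod k a≡b)

    ∣⇒≡0-mod : ∀ {a} → + n ∣ a → a ≡ 0ℤ [mod n ]
    ∣⇒≡0-mod {a} n∣a = congruent (subst (+ n ∣_) (sym (+-identityʳ a)) n∣a)

    ≡0-mod⇒∣ : ∀ {a} → a ≡ 0ℤ [mod n ] → + n ∣ a
    ≡0-mod⇒∣ {a} (congruent n∣a-0) = subst (+ n ∣_) (+-identityʳ a) n∣a-0

    -≡0⇒≡-mod : ∀ {a b} → a - b ≡ 0ℤ [mod n ] → a ≡ b [mod n ]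
    -≡0⇒≡-mod = congruent ∘ ≡0-mod⇒∣

    ≡-mod⇒-≡0 : ∀ {a b} → a ≡ b [mod n ] → a - b ≡ 0ℤ [mod n ]
    ≡-mod⇒-≡0 = ∣⇒≡0-mod ∘ _≡_[mod_].divides-difference

    n≡0-mod : + n ≡ 0ℤ [mod n ]
    n≡0-mod = ∣⇒≡0-mod ∣-refl

    pos-injective-mod : ∀ {a b} → a ℕ.< n → b ℕ.< n → + a ≡ + b [mod n ] → a ≡ b
    pos-injective-mod {a} {b} a<n b<n (congruent n∣a-b) =
      +-injective (i-j≡0⇒i≡j (+ a) (+ b) (∣i∣≡0⇒i≡0 (∣∧<⇒≡0 (∣⇒∣ᵤ n∣a-b) ∣a-b∣<n)))
      where
      ∣a-b∣<n : ∣ + a - + b ∣ ℕ.< n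
      ∣a-b∣<n = ℕ.≤-<-trans (ℕ.≤-reflexive (cong ∣_∣ (m-n≡m⊖n a b))) (ℕ.≤-<-trans (∣m⊝n∣≤m⊔n a b) (ℕ.⊔-lub a<n b<n))

  infix 4 _≡?_[mod_]
  _≡?_[mod_] : ∀ a b n → Dec (a ≡ b [mod n ])
  a ≡? b [mod n ] = Dec.map′ congruent _≡_[mod_].divides-difference (+ n ∣? a - b)

  ≡-mod-% : ∀ {n} .{{_ : ℕ.NonZero n}} z → z ≡ + (z % + n) [mod n ]
  ≡-mod-% {n} z = congruent (divides (z / + n) (begin
    z - + r                         ≡⟨ cong (_- + r) (a≡a%n+[a/n]*n z (+ n)) ⟩
    + r + (z / + n) * + n - + r     ≡⟨ cancel (+ r) ((z / + n) * + n) ⟩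
    (z / + n) * + n                 ∎))
    where
    open ≡-Reasoning
    r : ℕ
    r = z % + n
    cancel : ∀ r t → r + t - r ≡ t
    cancel = solve-∀

  pos-+-multiple-mod : ∀ {n} a q → + (a ℕ.+ q ℕ.* n) ≡ + a [mod n ]
  pos-+-multiple-mod {n} a q = congruent (divides (+ q) (begin
    + (a ℕ.+ q ℕ.* n) - + a   ≡⟨ cong (_- + a) (trans (pos-+ a (q ℕ.* n)) (cong (_+_ (+ a)) (pos-* q n))) ⟩
    + a + + q * + n - + a     ≡⟨ cancel (+ a) (+ q * + n) ⟩
    + q * + n                 ∎))
    where
    open ≡-Reasoning
    cancel : ∀ r t → r + t - r ≡ t
    cancel = solve-∀

  pos≢neg-mod : ∀ {n r s} → 0 ℕ.< r → r ℕ.+ s ℕ.< n → ¬ + r ≡ - + s [mod n ]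
  pos≢neg-mod {n} {r} {s} 0<r r+s<n r≡-s =
    ℕ.<⇒≢ (ℕ.≤-trans 0<r (ℕ.m≤m+n r s)) (sym (pos-injective-mod r+s<n (ℕ.≤-<-trans ℕ.z≤n r+s<n) r+s≡0))
    where
    r+s≡0 : + (r ℕ.+ s) ≡ + 0 [mod n ]
    r+s≡0 = ≡-mod-trans (≡⇒≡-mod (trans (pos-+ r s) (cong (_+_ (+ r)) (sym (neg-involutive (+ s))))))
                        (≡-mod⇒-≡0 r≡-s)

  ±-representative : ∀ {n h} → n ≡ suc (h ℕ.+ h) → ∀ z → ¬ z ≡ 0ℤ [mod n ] →
                     ∃ λ r → 0 ℕ.< r × r ℕ.≤ h × (z ≡ + r [mod n ] ⊎ z ≡ - + r [mod n ])
  ±-representative {n} {h} refl z z≢0 = representative (z % + n) (≡-mod-% z) (n%d<d z (+ n))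
    where
    representative : ∀ r₀ → z ≡ + r₀ [mod n ] → r₀ ℕ.< n →
                     ∃ λ r → 0 ℕ.< r × r ℕ.≤ h × (z ≡ + r [mod n ] ⊎ z ≡ - + r [mod n ])
    representative zero    z≡0  _    = contradiction z≡0 z≢0
    representative (suc r) z≡r₀ r₀<n with suc r ℕ.≤? h
    ... | yes r₀≤h = suc r , ℕ.s≤s ℕ.z≤n , r₀≤h , inj₁ z≡r₀
    ... | no  r₀≰h = n ℕ.∸ suc r , ℕ.m<n⇒0<n∸m r₀<n ,
                     ℕ.≤-trans (ℕ.∸-monoʳ-≤ n (ℕ.≰⇒> r₀≰h)) (ℕ.≤-reflexive (ℕ.m+n∸m≡n h h)) ,
                     inj₂ (≡-mod-trans z≡r₀ (-≡0⇒≡-mod (≡-mod-trans (≡⇒≡-mod r₀+[n∸r₀]) n≡0-mod)))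
      where
      r₀+[n∸r₀] : + suc r - - + (n ℕ.∸ suc r) ≡ + n
      r₀+[n∸r₀] = begin
        + suc r - - + (n ℕ.∸ suc r)  ≡⟨ cong (_+_ (+ suc r)) (neg-involutive (+ (n ℕ.∸ suc r))) ⟩
        + suc r + + (n ℕ.∸ suc r)    ≡⟨ pos-+ (suc r) _ ⟨
        + (suc r ℕ.+ (n ℕ.∸ suc r))  ≡⟨ cong +_ (ℕ.m+[n∸m]≡n (ℕ.<⇒≤ r₀<n)) ⟩
        + n                          ∎
        where open ≡-Reasoning

  0^n≡0 : ∀ {n} → 0 ℕ.< n → 0ℤ ^ n ≡ 0ℤ
  0^n≡0 {suc n} _ = refl

  pos-^ : ∀ a n → + (a ℕ.^ n) ≡ (+ a) ^ n
  pos-^ a zero    = refl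
  pos-^ a (suc n) = trans (pos-* a (a ℕ.^ n)) (cong ((+ a) *_) (pos-^ a n))

  -‿^-even : ∀ a m → (- a) ^ (2 ℕ.* m) ≡ a ^ (2 ℕ.* m)
  -‿^-even a m = begin
    (- a) ^ (2 ℕ.* m)  ≡⟨ ^-*-assoc (- a) 2 m ⟨
    ((- a) ^ 2) ^ m    ≡⟨ cong (_^ m) (square a) ⟩
    (a ^ 2) ^ m        ≡⟨ ^-*-assoc a 2 m ⟩
    a ^ (2 ℕ.* m)      ∎
    where
    open ≡-Reasoning
    square : ∀ a → - a * (- a * 1ℤ) ≡ a * (a * 1ℤ)
    square = solve-∀

  partialSum : (ℕ → ℤ) → ℕ → ℤ
  partialSum f zero    = 0ℤ
  partialSum f (suc m) = partialSum f m + f m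

  binomialTerm : ℕ → ℤ → ℕ → ℤ
  binomialTerm n x i = + (n C i) * x ^ i

  partialSum-pascal : ∀ n x m →
    partialSum (binomialTerm (suc n) x) (suc m) ≡
    partialSum (binomialTerm n x) (suc m) + x * partialSum (binomialTerm n x) m
  partialSum-pascal n x zero    = sym (cong (λ y → 1ℤ + y) (*-zeroʳ x))
  partialSum-pascal n x (suc m) = begin
    S′ (suc m) + + (suc n C suc m) * x ^ suc m
      ≡⟨ cong₂ (λ s c → s + + c * x ^ suc m) (partialSum-pascal n x m) (sym (nCk+nC[k+1]≡[n+1]C[k+1] n m)) ⟩
    S (suc m) + x * S m + + (n C m ℕ.+ n C suc m) * x ^ suc m
      ≡⟨ cong (λ c → S (suc m) + x * S m + c * x ^ suc m) (pos-+ (n C m) (n C suc m)) ⟩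
    S (suc m) + x * S m + (+ (n C m) + + (n C suc m)) * (x * x ^ m)
      ≡⟨ regroup (S (suc m)) (S m) x (+ (n C m)) (+ (n C suc m)) (x ^ m) ⟩
    S (suc m) + + (n C suc m) * x ^ suc m + x * (S m + + (n C m) * x ^ m)
      ∎
    where
    open ≡-Reasoning
    S S′ : ℕ → ℤ
    S  = partialSum (binomialTerm n x)
    S′ = partialSum (binomialTerm (suc n) x)
    regroup : ∀ A B x c c′ y → A + x * B + (c + c′) * (x * y) ≡ A + c′ * (x * y) + x * (B + c * y)
    regroup = solve-∀

  binomial-theorem : ∀ n x → (1ℤ + x) ^ n ≡ partialSum (binomialTerm n x) (suc n)
  binomial-theorem zero    x = refl
  binomial-theorem (suc n) x = begin
    (1ℤ + x) * (1ℤ + x) ^ n        ≡⟨ cong ((1ℤ + x) *_) (binomial-theorem n x) ⟩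
    (1ℤ + x) * S (suc n)           ≡⟨ distrib (S (suc n)) x ⟩
    S (suc n) + x * S (suc n)      ≡⟨ cong (_+ x * S (suc n)) top-term-vanishes ⟩
    S (suc (suc n)) + x * S (suc n) ≡⟨ partialSum-pascal n x (suc n) ⟨
    partialSum (binomialTerm (suc n) x) (suc (suc n)) ∎
    where
    open ≡-Reasoning
    S : ℕ → ℤ
    S = partialSum (binomialTerm n x)
    distrib : ∀ s x → (1ℤ + x) * s ≡ s + x * s
    distrib = solve-∀
    top-term-vanishes : S (suc n) ≡ S (suc n) + + (n C suc n) * x ^ suc n
    top-term-vanishes = sym (trans (cong (λ c → S (suc n) + + c * x ^ suc n) (k>n⇒nCk≡0 (ℕ.n<1+n n)))
                                   (+-identityʳ (S (suc n))))

  -- Polynomial n a f: f is a polynomial function of degree at most n with coefficient a at xⁿ,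
  -- given in Horner form f x = c + x * g x, so the innermost constant is the leading coefficient.
  data Polynomial : ℕ → ℤ → (ℤ → ℤ) → Set where
    constant : ∀ {a f} → (∀ x → f x ≡ a) → Polynomial 0 a f
    horner   : ∀ {n a f} c g → Polynomial n a g → (∀ x → f x ≡ c + x * g x) → Polynomial (suc n) a f

  factor-theorem : ∀ {n a f} → Polynomial (suc n) a f → ∀ r →
                   ∃ λ q → Polynomial n a q × (∀ x → f x - f r ≡ (x - r) * q x)
  factor-theorem {a = a} {f} (horner c g (constant g≡a) f≡) r =
    (λ _ → a) , constant (λ _ → refl) , λ x → begin
      f x - f r                     ≡⟨ cong₂ _-_ (f≡ x) (f≡ r) ⟩
      (c + x * g x) - (c + r * g r) ≡⟨ cong₂ (λ u v → (c + x * u) - (c + r * v)) (g≡a x) (g≡a r) ⟩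
      (c + x * a) - (c + r * a)     ≡⟨ regroup c x r a ⟩
      (x - r) * a                   ∎
    where
    open ≡-Reasoning
    regroup : ∀ c x r a → (c + x * a) - (c + r * a) ≡ (x - r) * a
    regroup = solve-∀
  factor-theorem {f = f} (horner c g g-poly@(horner _ _ _ _) f≡) r
    with q , q-poly , g-factors ← factor-theorem g-poly r =
    (λ x → g r + x * q x) , horner (g r) q q-poly (λ _ → refl) , λ x → begin
      f x - f r                           ≡⟨ cong₂ _-_ (f≡ x) (f≡ r) ⟩
      (c + x * g x) - (c + r * g r)       ≡⟨ split c x r (g x) (g r) ⟩
      x * (g x - g r) + (x - r) * g r     ≡⟨ cong (λ d → x * d + (x - r) * g r) (g-factors x) ⟩
      x * ((x - r) * q x) + (x - r) * g r ≡⟨ collect x r (q x) (g r) ⟩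
      (x - r) * (g r + x * q x)           ∎
    where
    open ≡-Reasoning
    split : ∀ c x r gx gr → (c + x * gx) - (c + r * gr) ≡ x * (gx - gr) + (x - r) * gr
    split = solve-∀
    collect : ∀ x r qx gr → x * ((x - r) * qx) + (x - r) * gr ≡ (x - r) * (gr + x * qx)
    collect = solve-∀

  power-polynomial : ∀ n → Polynomial n 1ℤ (_^ n)
  power-polynomial zero    = constant (λ _ → refl)
  power-polynomial (suc n) = horner 0ℤ (_^ n) (power-polynomial n) (λ x → sym (+-identityˡ (x * x ^ n)))

  power-minus-one-polynomial : ∀ n → Polynomial (suc n) 1ℤ (λ x → x ^ suc n - 1ℤ)
  power-minus-one-polynomial n = horner -1ℤ (_^ n) (power-polynomial n) (λ x → +-comm (x * x ^ n) -1ℤ)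

  -- Fermat's little theorem and Lagrange's bound on the number of roots

  module _ {p : ℕ} (p-prime : Prime p) where

    private instance
      _ = prime⇒nonZero p-prime

    0<p : 0 ℕ.< p
    0<p = ℕ.>-nonZero⁻¹ p

    1<p : 1 ℕ.< p
    1<p = ℕ.nonTrivial⇒n>1 p {{prime⇒nonTrivial p-prime}}

    ≡0-mod-* : ∀ {a b} → a * b ≡ 0ℤ [mod p ] → a ≡ 0ℤ [mod p ] ⊎ b ≡ 0ℤ [mod p ]
    ≡0-mod-* {a} {b} ab≡0 =
      Sum.map (∣⇒≡0-mod ∘ ∣ᵤ⇒∣) (∣⇒≡0-mod ∘ ∣ᵤ⇒∣)
        (euclidsLemma ∣ a ∣ ∣ b ∣ p-prime (subst (p ℕ.∣_) (abs-* a b) (∣⇒∣ᵤ (≡0-mod⇒∣ ab≡0))))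

    *-cancelˡ-mod : ∀ {a b c} → ¬ a ≡ 0ℤ [mod p ] → a * b ≡ a * c [mod p ] → b ≡ c [mod p ]
    *-cancelˡ-mod {a} {b} {c} a≢0 (congruent p∣ab-ac)
      with ≡0-mod-* (∣⇒≡0-mod (subst (+ p ∣_) (factor a b c) p∣ab-ac))
      where factor : ∀ a b c → a * b - a * c ≡ a * (b - c)
            factor = solve-∀
    ... | inj₁ a≡0   = contradiction a≡0 a≢0
    ... | inj₂ b-c≡0 = congruent (≡0-mod⇒∣ b-c≡0)

    partialSum-binomialTerm≡1 : ∀ x j → 0 ℕ.< j → j ℕ.≤ p → partialSum (binomialTerm p x) j ≡ 1ℤ [mod p ]
    partialSum-binomialTerm≡1 x 1             _ _   = ≡-mod-refl
    partialSum-binomialTerm≡1 x (suc (suc j)) _ j<p =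
      +-cong-mod (partialSum-binomialTerm≡1 x (suc j) (ℕ.s≤s ℕ.z≤n) (ℕ.<⇒≤ j<p))
                 (∣⇒≡0-mod (∣m⇒∣m*n {m = + (p C suc j)} (x ^ suc j) p∣C))
      where
      p∣C : + p ∣ + (p C suc j)
      p∣C = ∣ᵤ⇒∣ (prime∣C p-prime (ℕ.s≤s ℕ.z≤n) j<p)

    freshman's-dream : ∀ x → (1ℤ + x) ^ p ≡ 1ℤ + x ^ p [mod p ]
    freshman's-dream x = begin
      (1ℤ + x) ^ p
        ≡⟨ binomial-theorem p x ⟩
      partialSum (binomialTerm p x) p + + (p C p) * x ^ p
        ≈⟨ +-cong-mod (partialSum-binomialTerm≡1 x p 0<p ℕ.≤-refl) ≡-mod-refl ⟩
      1ℤ + + (p C p) * x ^ p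
        ≡⟨ cong (λ c → 1ℤ + + c * x ^ p) (nCn≡1 p) ⟩
      1ℤ + 1ℤ * x ^ p
        ≡⟨ cong (λ y → 1ℤ + y) (*-identityˡ (x ^ p)) ⟩
      1ℤ + x ^ p
        ∎
      where open SetoidReasoning ≡-mod-setoid

    fermat : ∀ a → (+ a) ^ p ≡ + a [mod p ]
    fermat zero    = ≡⇒≡-mod (0^n≡0 0<p)
    fermat (suc a) = ≡-mod-trans (freshman's-dream (+ a)) (+-cong-mod (≡-mod-refl {a = 1ℤ}) (fermat a))

    fermat-unit : ∀ a → ¬ + a ≡ 0ℤ [mod p ] → (+ a) ^ (p ℕ.∸ 1) ≡ 1ℤ [mod p ]
    fermat-unit a a≢0 = *-cancelˡ-mod a≢0 (begin
      + a * (+ a) ^ (p ℕ.∸ 1) ≡⟨ cong ((+ a) ^_) (ℕ.suc-pred p) ⟩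
      (+ a) ^ p               ≈⟨ fermat a ⟩
      + a                     ≡⟨ *-identityʳ (+ a) ⟨
      + a * 1ℤ                ∎)
      where open SetoidReasoning ≡-mod-setoid

    roots-≤-degree : ∀ {n a f} → ¬ a ≡ 0ℤ [mod p ] → Polynomial n a f → (rs : List ℤ) →
                     AllPairs (λ r s → ¬ r ≡ s [mod p ]) rs → All (λ r → f r ≡ 0ℤ [mod p ]) rs →
                     length rs ℕ.≤ n
    roots-≤-degree a≢0 _ [] _ _ = ℕ.z≤n
    roots-≤-degree a≢0 (constant f≡a) (r ∷ _) _ (fr≡0 ∷ _) =
      contradiction (≡-mod-trans (≡⇒≡-mod (sym (f≡a r))) fr≡0) a≢0
    roots-≤-degree {f = f} a≢0 f-poly@(horner _ _ _ _) (r ∷ rs) (r≢rs ∷ rs-distinct) (fr≡0 ∷ frs≡0)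
      with q , q-poly , f-factors ← factor-theorem f-poly r =
      ℕ.s≤s (roots-≤-degree a≢0 q-poly rs rs-distinct (All.zipWith root-of-quotient (r≢rs , frs≡0)))
      where
      root-of-quotient : ∀ {s} → (¬ r ≡ s [mod p ]) × f s ≡ 0ℤ [mod p ] → q s ≡ 0ℤ [mod p ]
      root-of-quotient {s} (r≢s , fs≡0)
        with ≡0-mod-* (≡-mod-trans (≡⇒≡-mod (sym (f-factors s))) (+-cong-mod fs≡0 (-‿cong-mod fr≡0)))
      ... | inj₁ s-r≡0 = contradiction (≡-mod-sym (-≡0⇒≡-mod s-r≡0)) r≢s
      ... | inj₂ qs≡0  = qs≡0

    1≢0-mod : ¬ 1ℤ ≡ 0ℤ [mod p ]
    1≢0-mod 1≡0 with () ← pos-injective-mod 1<p 0<p 1≡0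

    roots-of-unity-≤ : ∀ {n} → 0 ℕ.< n → (rs : List ℤ) → AllPairs (λ r s → ¬ r ≡ s [mod p ]) rs →
                       All (λ r → r ^ n ≡ 1ℤ [mod p ]) rs → length rs ℕ.≤ n
    roots-of-unity-≤ {suc n} _ rs rs-distinct rs-roots =
      roots-≤-degree 1≢0-mod (power-minus-one-polynomial n) rs rs-distinct (All.map ≡-mod⇒-≡0 rs-roots)

  -- Integer vectors of bounded ℓ¹-norm

  infix 7 _∙_
  _∙_ : ∀ {m} → Vec ℤ m → Vec ℤ m → ℤ
  []      ∙ []      = 0ℤ
  (a ∷ e) ∙ (x ∷ u) = a * x + e ∙ u

  ‖_‖₁ : ∀ {m} → Vec ℤ m → ℕ
  ‖ []    ‖₁ = 0
  ‖ a ∷ e ‖₁ = ∣ a ∣ ℕ.+ ‖ e ‖₁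

  ∙-zeroˡ : ∀ {m} (u : Vec ℤ m) → Vec.replicate m 0ℤ ∙ u ≡ 0ℤ
  ∙-zeroˡ []      = refl
  ∙-zeroˡ (x ∷ u) = trans (+-identityˡ _) (∙-zeroˡ u)

  ‖zero‖₁ : ∀ m → ‖ Vec.replicate m 0ℤ ‖₁ ≡ 0
  ‖zero‖₁ zero    = refl
  ‖zero‖₁ (suc m) = ‖zero‖₁ m

  ∙-distribʳ-+ : ∀ {m} (e f u : Vec ℤ m) → Vec.zipWith _+_ e f ∙ u ≡ e ∙ u + f ∙ u
  ∙-distribʳ-+ []      []      []      = refl
  ∙-distribʳ-+ (a ∷ e) (b ∷ f) (x ∷ u) = begin
    (a + b) * x + Vec.zipWith _+_ e f ∙ u ≡⟨ cong (λ t → (a + b) * x + t) (∙-distribʳ-+ e f u) ⟩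
    (a + b) * x + (e ∙ u + f ∙ u)         ≡⟨ regroup a b x (e ∙ u) (f ∙ u) ⟩
    (a * x + e ∙ u) + (b * x + f ∙ u)     ∎
    where
    open ≡-Reasoning
    regroup : ∀ a b x s t → (a + b) * x + (s + t) ≡ (a * x + s) + (b * x + t)
    regroup = solve-∀

  ‖‖₁-triangle : ∀ {m} (e f : Vec ℤ m) → ‖ Vec.zipWith _+_ e f ‖₁ ℕ.≤ ‖ e ‖₁ ℕ.+ ‖ f ‖₁
  ‖‖₁-triangle []      []      = ℕ.z≤n
  ‖‖₁-triangle (a ∷ e) (b ∷ f) = ℕ.≤-trans (ℕ.+-mono-≤ (∣i+j∣≤∣i∣+∣j∣ a b) (‖‖₁-triangle e f))
                                           (ℕ.≤-reflexive (interchange ∣ a ∣ ∣ b ∣ ‖ e ‖₁ ‖ f ‖₁))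

  signedUnit : ∀ {m x} {u : Vec ℤ m} → x ∈ᵥ u → ℤ → Vec ℤ m
  signedUnit {u = _ ∷ _} (Vecᵃ.here _)    s = s ∷ Vec.replicate _ 0ℤ
  signedUnit {u = _ ∷ _} (Vecᵃ.there x∈u) s = 0ℤ ∷ signedUnit x∈u s

  signedUnit-∙ : ∀ {m x} {u : Vec ℤ m} (x∈u : x ∈ᵥ u) s → signedUnit x∈u s ∙ u ≡ s * x
  signedUnit-∙ {u = _ ∷ u} (Vecᵃ.here refl) s = trans (cong (λ t → s * _ + t) (∙-zeroˡ u)) (+-identityʳ _)
  signedUnit-∙ {u = _ ∷ u} (Vecᵃ.there x∈u) s = trans (+-identityˡ _) (signedUnit-∙ x∈u s)

  ‖signedUnit‖₁ : ∀ {m x} {u : Vec ℤ m} (x∈u : x ∈ᵥ u) s → ‖ signedUnit x∈u s ‖₁ ≡ ∣ s ∣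
  ‖signedUnit‖₁ {suc m} (Vecᵃ.here _) s = trans (cong (∣ s ∣ ℕ.+_) (‖zero‖₁ m)) (ℕ.+-identityʳ _)
  ‖signedUnit‖₁ (Vecᵃ.there x∈u) s = ‖signedUnit‖₁ x∈u s

  Combination : ∀ {m} → ℕ → Vec ℤ m → ℕ → ℤ → Set
  Combination n u g z = ∃ λ e → ‖ e ‖₁ ℕ.≤ g × z ≡ e ∙ u [mod n ]

  module _ {n m : ℕ} {u : Vec ℤ m} where

    combination-zero : ∀ {g} → Combination n u g 0ℤ
    combination-zero = Vec.replicate m 0ℤ , ℕ.≤-trans (ℕ.≤-reflexive (‖zero‖₁ m)) ℕ.z≤n , ≡⇒≡-mod (sym (∙-zeroˡ u))

    combination-+ : ∀ {g g′ z z′} → Combination n u g z → Combination n u g′ z′ →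
                    Combination n u (g ℕ.+ g′) (z + z′)
    combination-+ (e , ‖e‖≤g , z≡eu) (f , ‖f‖≤g′ , z′≡fu) =
      Vec.zipWith _+_ e f ,
      ℕ.≤-trans (‖‖₁-triangle e f) (ℕ.+-mono-≤ ‖e‖≤g ‖f‖≤g′) ,
      ≡-mod-trans (+-cong-mod z≡eu z′≡fu) (≡⇒≡-mod (sym (∙-distribʳ-+ e f u)))

    combination-resp : ∀ {g z z′} → z ≡ z′ [mod n ] → Combination n u g z′ → Combination n u g z
    combination-resp z≡z′ (e , ‖e‖≤g , z′≡eu) = e , ‖e‖≤g , ≡-mod-trans z≡z′ z′≡eu

    combination-± : ∀ {x} → x ∈ᵥ u → ∀ s → ∣ s ∣ ≡ 1 → Combination n u 1 (s * x)
    combination-± x∈u s ∣s∣≡1 =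
      signedUnit x∈u s , ℕ.≤-reflexive (trans (‖signedUnit‖₁ x∈u s) ∣s∣≡1) , ≡⇒≡-mod (sym (signedUnit-∙ x∈u s))

  step : Sign → ℤ → ℤ
  step Sign.+ = ℤ.suc
  step Sign.- = ℤ.pred

  step-◃ : ∀ s c → step s (s ◃ c) ≡ s ◃ suc c
  step-◃ Sign.+ zero    = refl
  step-◃ Sign.+ (suc c) = refl
  step-◃ Sign.- zero    = refl
  step-◃ Sign.- (suc c) = refl

  stepHead : ∀ {m} → Sign → Vec ℤ (suc m) → Vec ℤ (suc m)
  stepHead s (z ∷ e) = step s z ∷ e

  -- cone s m g lists the vectors (s ◃ c) ∷ e with c + ‖ e ‖₁ ≤ g.  A zero head lies in both cones,
  -- so ball lists some vectors twice; its length is the count ballSize.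
  mutual
    ball : (m g : ℕ) → List (Vec ℤ m)
    ball zero    g = [] ∷ []
    ball (suc m) g = cone Sign.+ m g ++ cone Sign.- m g

    cone : Sign → (m g : ℕ) → List (Vec ℤ (suc m))
    cone s m zero    = List.map (0ℤ ∷_) (ball m zero)
    cone s m (suc g) = List.map (0ℤ ∷_) (ball m (suc g)) ++ List.map (stepHead s) (cone s m g)

  mutual
    length-ball : ∀ m g → length (ball m g) ≡ ballSize m g
    length-ball zero    g = refl
    length-ball (suc m) g =
      trans (length-++ (cone Sign.+ m g)) (cong₂ ℕ._+_ (length-cone Sign.+ m g) (length-cone Sign.- m g))

    length-cone : ∀ s m g → length (cone s m g) ≡ coneSize m g
    length-cone s m zero    = trans (length-map _ (ball m zero)) (length-ball m zero)
    length-cone s m (suc g) =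
      trans (length-++ (List.map (0ℤ ∷_) (ball m (suc g))))
            (cong₂ ℕ._+_ (trans (length-map _ (ball m (suc g))) (length-ball m (suc g)))
                         (trans (length-map _ (cone s m g)) (length-cone s m g)))

  mutual
    ∈-ball : ∀ {m g} (e : Vec ℤ m) → ‖ e ‖₁ ℕ.≤ g → e ∈ ball m g
    ∈-ball []                  _   = here refl
    ∈-ball {suc m} {g} (z ∷ e) ‖e‖≤g = subst (λ z → z ∷ e ∈ ball (suc m) g) (◃-inverse z) (∈-cones (sign z))
      where
      ∈-cones : ∀ s → (s ◃ ∣ z ∣) ∷ e ∈ ball (suc m) g
      ∈-cones Sign.+ = ∈-++⁺ˡ (∈-cone Sign.+ ∣ z ∣ e ‖e‖≤g)
      ∈-cones Sign.- = ∈-++⁺ʳ (cone Sign.+ m g) (∈-cone Sign.- ∣ z ∣ e ‖e‖≤g)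

    ∈-cone : ∀ {m g} s c (e : Vec ℤ m) → c ℕ.+ ‖ e ‖₁ ℕ.≤ g → (s ◃ c) ∷ e ∈ cone s m g
    ∈-cone {g = zero}  s zero    e ‖e‖≤g = ∈-map⁺ (0ℤ ∷_) (∈-ball e ‖e‖≤g)
    ∈-cone {g = suc g} s zero    e ‖e‖≤g = ∈-++⁺ˡ (∈-map⁺ (0ℤ ∷_) (∈-ball e ‖e‖≤g))
    ∈-cone {m} {suc g} s (suc c) e (ℕ.s≤s c+‖e‖≤g) =
      ∈-++⁺ʳ (List.map (0ℤ ∷_) (ball m (suc g)))
        (subst (_∈ List.map (stepHead s) (cone s m g)) (cong (_∷ e) (step-◃ s c)) (∈-map⁺ (stepHead s) (∈-cone s c e c+‖e‖≤g)))

  covering⇒≤ballSize : ∀ {n m g} (u : Vec ℤ m) → (∀ (a : Fin n) → Combination n u g (+ toℕ a)) →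
                       n ℕ.≤ ballSize m g
  covering⇒≤ballSize {n} {m} {g} u cover = begin
    n                 ≤⟨ injective⇒≤ index-injective ⟩
    length values     ≡⟨ length-map (_∙ u) (ball m g) ⟩
    length (ball m g) ≡⟨ length-ball m g ⟩
    ballSize m g      ∎
    where
    open ℕ.≤-Reasoning
    values : List ℤ
    values = List.map (_∙ u) (ball m g)
    representative∈values : ∀ a → proj₁ (cover a) ∙ u ∈ values
    representative∈values a = ∈-map⁺ (_∙ u) (∈-ball (proj₁ (cover a)) (proj₁ (proj₂ (cover a))))
    index : Fin n → Fin (length values)
    index a = Any.index (representative∈values a)
    a≡value : ∀ a → + toℕ a ≡ List.lookup values (index a) [mod n ]
    a≡value a = ≡-mod-trans (proj₂ (proj₂ (cover a))) (≡⇒≡-mod (lookup-index (representative∈values a)))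
    index-injective : ∀ {a b} → index a ≡ index b → a ≡ b
    index-injective {a} {b} ia≡ib = toℕ-injective (pos-injective-mod (toℕ<n a) (toℕ<n b)
      (≡-mod-trans (a≡value a) (≡-mod-sym (subst (λ i → + toℕ b ≡ List.lookup values i [mod n ]) (sym ia≡ib) (a≡value b)))))

  -- Sums of k-th powers modulo p = 2km + 1

  module _ {p k m : ℕ} (p-prime : Prime p) (p∸1≡k*2m : p ℕ.∸ 1 ≡ k ℕ.* (2 ℕ.* m)) where

    private
      h d : ℕ
      h = k ℕ.* m
      d = 2 ℕ.* m

      instance
        _ = prime⇒nonZero p-prime

    p≡2h+1 : p ≡ suc (h ℕ.+ h)
    p≡2h+1 = trans (sym (ℕ.suc-pred p)) (cong suc (trans p∸1≡k*2m (double k m)))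
      where double : ∀ k m → k ℕ.* (2 ℕ.* m) ≡ k ℕ.* m ℕ.+ k ℕ.* m
            double = ℕ-Solver.solve-∀

    0<k*d : 0 ℕ.< k ℕ.* d
    0<k*d = subst (0 ℕ.<_) p∸1≡k*2m (ℕ.m<n⇒0<n∸m (1<p p-prime))

    0<k : 0 ℕ.< k
    0<k = ℕ.>-nonZero⁻¹ k {{ℕ.m*n≢0⇒m≢0 k {{ℕ.>-nonZero 0<k*d}}}}

    0<d : 0 ℕ.< d
    0<d = ℕ.>-nonZero⁻¹ d {{ℕ.m*n≢0⇒n≢0 k {{ℕ.>-nonZero 0<k*d}}}}

    ≤h⇒<p : ∀ {r} → r ℕ.≤ h → r ℕ.< p
    ≤h⇒<p r≤h = subst (_ ℕ.<_) (sym p≡2h+1) (ℕ.s≤s (ℕ.≤-trans r≤h (ℕ.m≤m+n h h)))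

    root? : ∀ r → Dec ((+ r) ^ d ≡ 1ℤ [mod p ])
    root? r = (+ r) ^ d ≡? 1ℤ [mod p ]

    halfRoots : List ℕ
    halfRoots = List.filter root? (List.applyUpTo suc h)

    halfRoots-range : All (λ r → 0 ℕ.< r × r ℕ.≤ h) halfRoots
    halfRoots-range = AllP.filter⁺ root? (AllP.applyUpTo⁺₁ suc h (λ i<h → ℕ.s≤s ℕ.z≤n , i<h))

    halfRoots-roots : All (λ r → (+ r) ^ d ≡ 1ℤ [mod p ]) halfRoots
    halfRoots-roots = AllP.all-filter root? (List.applyUpTo suc h)

    halfRoots-distinct : AllPairs (λ r s → ¬ + r ≡ + s [mod p ]) halfRoots
    halfRoots-distinct = AllPairsP.filter⁺ root? (AllPairsP.applyUpTo⁺₁ suc h distinct)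
      where
      distinct : ∀ {i j} → i ℕ.< j → j ℕ.< h → ¬ + suc i ≡ + suc j [mod p ]
      distinct i<j j<h i≡j =
        ℕ.<⇒≢ i<j (ℕ.suc-injective (pos-injective-mod (≤h⇒<p (ℕ.<-trans i<j j<h)) (≤h⇒<p j<h) i≡j))

    ∈-halfRoots : ∀ {r} → 0 ℕ.< r → r ℕ.≤ h → (+ r) ^ d ≡ 1ℤ [mod p ] → r ∈ halfRoots
    ∈-halfRoots {suc r} _ r<h rᵈ≡1 = ∈-filter⁺ root? (∈-applyUpTo⁺ suc r<h) rᵈ≡1

    signedHalfRoots : List ℤ
    signedHalfRoots = List.map +_ halfRoots ++ List.map (λ r → - + r) halfRoots

    signedHalfRoots-distinct : AllPairs (λ r s → ¬ r ≡ s [mod p ]) signedHalfRoots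
    signedHalfRoots-distinct = AllPairsP.++⁺
      (AllPairsP.map⁺ halfRoots-distinct)
      (AllPairsP.map⁺ (AllPairs.map (λ r≢s -r≡-s → r≢s (neg-injective-mod -r≡-s)) halfRoots-distinct))
      (AllP.map⁺ (All.map (λ r-range → AllP.map⁺ (All.map (pos≢neg r-range) halfRoots-range)) halfRoots-range))
      where
      neg-injective-mod : ∀ {a b} → - a ≡ - b [mod p ] → a ≡ b [mod p ]
      neg-injective-mod {a} {b} -a≡-b = subst₂ _≡_[mod p ] (neg-involutive a) (neg-involutive b) (-‿cong-mod -a≡-b)
      pos≢neg : ∀ {r s} → 0 ℕ.< r × r ℕ.≤ h → 0 ℕ.< s × s ℕ.≤ h → ¬ + r ≡ - + s [mod p ]
      pos≢neg (0<r , r≤h) (_ , s≤h) = pos≢neg-mod 0<r (subst (_ ℕ.<_) (sym p≡2h+1) (ℕ.s≤s (ℕ.+-mono-≤ r≤h s≤h)))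

    signedHalfRoots-roots : All (λ r → r ^ d ≡ 1ℤ [mod p ]) signedHalfRoots
    signedHalfRoots-roots = AllP.++⁺ (AllP.map⁺ halfRoots-roots)
      (AllP.map⁺ (All.map (≡-mod-trans (≡⇒≡-mod (-‿^-even _ m))) halfRoots-roots))

    -- Lagrange's bound for y^d − 1, applied to the half roots and their negatives (roots too, as d
    -- is even), gives 2 · length halfRoots ≤ d.
    halfRoots-length : length halfRoots ℕ.≤ m
    halfRoots-length = ℕ.*-cancelˡ-≤ 2 (begin
      2 ℕ.* length halfRoots                    ≡⟨ cong (length halfRoots ℕ.+_) (ℕ.+-identityʳ _) ⟩
      length halfRoots ℕ.+ length halfRoots     ≡⟨ cong₂ ℕ._+_ (length-map +_ halfRoots) (length-map _ halfRoots) ⟨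
      length (List.map +_ halfRoots) ℕ.+ length (List.map (λ r → - + r) halfRoots)
                                                ≡⟨ length-++ (List.map +_ halfRoots) ⟨
      length signedHalfRoots                    ≤⟨ roots-of-unity-≤ p-prime 0<d signedHalfRoots
                                                     signedHalfRoots-distinct signedHalfRoots-roots ⟩
      d                                         ∎)
      where open ℕ.≤-Reasoning

    halfRootVector : Vec ℤ (length (List.map +_ halfRoots))
    halfRootVector = Vec.fromList (List.map +_ halfRoots)

    ∈-halfRootVector : ∀ r → 0 ℕ.< r → r ℕ.≤ h → (+ r) ^ d ≡ 1ℤ [mod p ] → + r ∈ᵥ halfRootVector
    ∈-halfRootVector r 0<r r≤h rᵈ≡1 = ∈-fromList⁺ (∈-map⁺ +_ (∈-halfRoots 0<r r≤h rᵈ≡1))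

    root-combination : ∀ z → z ^ d ≡ 1ℤ [mod p ] → Combination p halfRootVector 1 z
    root-combination z zᵈ≡1 with ±-representative p≡2h+1 z z≢0
      where
      z≢0 : ¬ z ≡ 0ℤ [mod p ]
      z≢0 z≡0 = 1≢0-mod p-prime (≡-mod-trans (≡-mod-sym zᵈ≡1) (≡-mod-trans (^-cong-mod d z≡0) (≡⇒≡-mod (0^n≡0 0<d))))
    ... | r , 0<r , r≤h , inj₁ z≡r =
      combination-resp (≡-mod-trans z≡r (≡⇒≡-mod (sym (*-identityˡ (+ r)))))
                       (combination-± (∈-halfRootVector r 0<r r≤h rᵈ≡1) 1ℤ refl)
      where
      rᵈ≡1 : (+ r) ^ d ≡ 1ℤ [mod p ]
      rᵈ≡1 = ≡-mod-trans (^-cong-mod d (≡-mod-sym z≡r)) zᵈ≡1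
    ... | r , 0<r , r≤h , inj₂ z≡-r =
      combination-resp (≡-mod-trans z≡-r (≡⇒≡-mod (sym (-1*i≡-i (+ r)))))
                       (combination-± (∈-halfRootVector r 0<r r≤h rᵈ≡1) -1ℤ refl)
      where
      rᵈ≡1 : (+ r) ^ d ≡ 1ℤ [mod p ]
      rᵈ≡1 = ≡-mod-trans (≡⇒≡-mod (sym (-‿^-even (+ r) m))) (≡-mod-trans (^-cong-mod d (≡-mod-sym z≡-r)) zᵈ≡1)

    power-combination : ∀ x → Combination p halfRootVector 1 ((+ x) ^ k)
    power-combination x with + x ≡? 0ℤ [mod p ]
    ... | yes x≡0 = combination-resp (≡-mod-trans (^-cong-mod k x≡0) (≡⇒≡-mod (0^n≡0 0<k))) combination-zero
    ... | no  x≢0 = root-combination ((+ x) ^ k) (≡-mod-trans (≡⇒≡-mod xᵏᵈ≡xᵖ⁻¹) (fermat-unit p-prime x x≢0))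
      where
      xᵏᵈ≡xᵖ⁻¹ : ((+ x) ^ k) ^ d ≡ (+ x) ^ (p ℕ.∸ 1)
      xᵏᵈ≡xᵖ⁻¹ = trans (^-*-assoc (+ x) k d) (cong ((+ x) ^_) (sym p∸1≡k*2m))

    sum-combination : ∀ {s} (xs : Vec ℕ s) → Combination p halfRootVector s (+ Vec.sum (Vec.map (ℕ._^ k) xs))
    sum-combination []       = combination-zero
    sum-combination (x ∷ xs) =
      subst (Combination p halfRootVector _) (sym (trans (pos-+ (x ℕ.^ k) _) (cong (_+ _) (pos-^ x k))))
            (combination-+ (power-combination x) (sum-combination xs))

    AllSumsOfPowers⇒p≤ballSize : ∀ {g} → AllSumsOfPowers k p g → p ℕ.≤ ballSize m g
    AllSumsOfPowers⇒p≤ballSize {g} all-sums = begin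
      p                                      ≤⟨ covering⇒≤ballSize halfRootVector residue-combination ⟩
      ballSize (length (List.map +_ halfRoots)) g ≤⟨ ballSize-monoˡ g (ℕ.≤-trans (ℕ.≤-reflexive (length-map +_ halfRoots)) halfRoots-length) ⟩
      ballSize m g                           ∎
      where
      open ℕ.≤-Reasoning
      residue-combination : ∀ a → Combination p halfRootVector g (+ toℕ a)
      residue-combination a with xs , q , sum≡a+qp ← all-sums a =
        combination-resp (≡-mod-sym (subst (λ t → + t ≡ + toℕ a [mod p ]) (sym sum≡a+qp) (pos-+-multiple-mod (toℕ a) q)))
                         (sum-combination xs)

open import Data.Nat using (ℕ; _+_; _*_; _^_; _≤_; _∸_; _/_; _%_)
open import Data.Nat.Primality using (Prime)
open import Data.Product using (_×_)
open import Relation.Binary.PropositionalEquality using (_≡_)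

open import Data.Nat.Base using (NonZero; _!)
open import Data.Nat.Properties using (≤-trans; ≤-reflexive; *-monoʳ-≤)
open import Data.Product using (_,_)

waring-number-bound : ∀ {p g} m .{{_ : NonZero (2 * m)}} → Prime p → p % (2 * m) ≡ 1 →
                      IsWaringNumber ((p ∸ 1) / (2 * m)) p g → m ! * p ≤ risingEvens m g
waring-number-bound {p} {g} m p-prime p%2m≡1 (_ , all-sums , _) = ≤-trans
  (*-monoʳ-≤ (m !) (AllSumsOfPowers⇒p≤ballSize {k = (p ∸ 1) / (2 * m)} {m} p-prime
                     (m%n≡1⇒m∸1≡[m∸1]/n*n p (2 * m) p%2m≡1) all-sums))
  (≤-reflexive (ballSize-closed-form m g))

corollary7p2 : (p : ℕ) → Prime p → p % 2 ≡ 1 →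
  ((p % 4 ≡ 1) → (g : ℕ) → IsWaringNumber ((p ∸ 1) / 4) p g → 2 * p ≤ (2 * g + 3) ^ 2) ×
  ((p % 6 ≡ 1) → (g : ℕ) → IsWaringNumber ((p ∸ 1) / 6) p g → 6 * p ≤ (2 * g + 4) ^ 3) ×
  ((p % 8 ≡ 1) → (g : ℕ) → IsWaringNumber ((p ∸ 1) / 8) p g → 24 * p ≤ (2 * g + 5) ^ 4) ×
  ((p % 10 ≡ 1) → (g : ℕ) → IsWaringNumber ((p ∸ 1) / 10) p g → 120 * p ≤ (2 * g + 6) ^ 5)
corollary7p2 p p-prime _ =
  (λ p%4≡1 g w → ≤-trans (waring-number-bound 2 p-prime p%4≡1 w) (risingEvens-2≤ g)) ,
  (λ p%6≡1 g w → ≤-trans (waring-number-bound 3 p-prime p%6≡1 w) (risingEvens-3≤ g)) ,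
  (λ p%8≡1 g w → ≤-trans (waring-number-bound 4 p-prime p%8≡1 w) (risingEvens-4≤ g)) ,
  (λ p%10≡1 g w → ≤-trans (waring-number-bound 5 p-prime p%10≡1 w) (risingEvens-5≤ g))
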